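{- Let $\mathsf{M}^s=\{\langle v,\mathfrak{R}\rangle:\mathfrak{R}\text{ symmetric}\}$, $\mathsf{M}^n=\{\langle v,\mathfrak{R}\rangle: \text{for all }\varphi,\psi,\ \langle\neg\varphi,\psi\rangle\in\mathfrak{R}\Rightarrow\langle\varphi,\psi\rangle\in\mathfrak{R}\}$, and let $\mathsf{R}^s$, $\mathsf{R}^n$ be the corresponding sets of relations (symmetric relations, resp. relations with $\langle\neg\varphi,\psi\rangle\in\mathfrak{R}\Rightarrow\langle\varphi,\psi\rangle\in\mathfrak{R}$). Then $\mathsf{M}^s\cap\mathsf{M}^n$ is not a definable set of models and $\mathsf{R}^s\cap\mathsf{R}^n$ is not a definable set of relations.
   Context: Let $\Phi=\{p_0,p_1,\dots\}$ be a countably infinite set of propositional letters; $\mathsf{FOR}$ is the set of formulas built from $\Phi$ with $\neg$ and binary $\lor,\wedge,\to,\leftrightarrow,\vartriangle,\looparrowright$. An Epstein relation is any $\mathfrak{R}\subseteq\mathsf{FOR}^2$; an Epstein model is $\langle v,\mathfrak{R}\rangle$ with $v:\Phi\to\{0,1\}$. Truth: $\langle v,\mathfrak{R}\rangle\vDash p$ iff $v(p)=1$; classical clauses for $\neg,\wedge,\lor,\to,\leftrightarrow$; $\vDash\psi\vartriangle\chi$ iff both $\psi,\chi$ true and $\langle\psi,\chi\rangle\in\mathfrak{R}$; $\vDash\psi\looparrowright\chi$ iff ($\psi$ false or $\chi$ true) and $\langle\psi,\chi\rangle\in\mathfrak{R}$. A model satisfies $\Gamma$ if it satisfies each member; $\mathfrak{R}\vDash\Gamma$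 iff $\langle v,\mathfrak{R}\rangle\vDash\Gamma$ for every $v$. A set $\mathsf{K}$ of relations is definable iff there is $\Gamma\subseteq\mathsf{FOR}$ with: for every relation $\mathfrak{R}$, $\mathfrak{R}\vDash\Gamma$ iff $\mathfrak{R}\in\mathsf{K}$. A set $\mathsf{K}$ of Epstein models is definable iff there is $\Gamma\subseteq\mathsf{FOR}$ with: for every Epstein model $\mathfrak{M}$, $\mathfrak{M}\vDash\Gamma$ iff $\mathfrak{M}\in\mathsf{K}$. -}

module Defs where

open import Data.Nat using (ℕ)
open import Data.Bool using (Bool; true; false; not; _∧_; _∨_; if_then_else_)
open import Data.Product using (Σ; _×_; _,_)
open import Relation.Binary.PropositionalEquality using (_≡_)
open import Function.Bundles using (_⇔_)

data FOR : Set where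
  var  : ℕ → FOR
  ¬'_  : FOR → FOR
  _∨'_ : FOR → FOR → FOR
  _∧'_ : FOR → FOR → FOR
  _→'_ : FOR → FOR → FOR
  _↔'_ : FOR → FOR → FOR
  _△_  : FOR → FOR → FOR
  _↬_  : FOR → FOR → FOR

Valuation : Set
Valuation = ℕ → Bool

ERel : Set
ERel = FOR → FOR → Bool

_∈R_ : FOR × FOR → ERel → Set
(φ , ψ) ∈R R = R φ ψ ≡ true

Model : Set
Model = Valuation × ERel

imp : Bool → Bool → Bool
imp a b = not a ∨ b

iff : Bool → Bool → Bool
iff a b = if a then b else not b

⟦_⟧ : FOR → Model → Bool
⟦ var n ⟧ (v , R) = v n
⟦ ¬' φ ⟧ M = not (⟦ φ ⟧ M)
⟦ φ ∨' ψ ⟧ M = ⟦ φ ⟧ M ∨ ⟦ ψ ⟧ M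
⟦ φ ∧' ψ ⟧ M = ⟦ φ ⟧ M ∧ ⟦ ψ ⟧ M
⟦ φ →' ψ ⟧ M = imp (⟦ φ ⟧ M) (⟦ ψ ⟧ M)
⟦ φ ↔' ψ ⟧ M = iff (⟦ φ ⟧ M) (⟦ ψ ⟧ M)
⟦ φ △ ψ ⟧ (v , R) = (⟦ φ ⟧ (v , R) ∧ ⟦ ψ ⟧ (v , R)) ∧ R φ ψ
⟦ φ ↬ ψ ⟧ (v , R) = imp (⟦ φ ⟧ (v , R)) (⟦ ψ ⟧ (v , R)) ∧ R φ ψ

_⊨_ : Model → FOR → Set
M ⊨ φ = ⟦ φ ⟧ M ≡ true

FormulaSet : Set₁
FormulaSet = FOR → Set

_⊨Γ_ : Model → FormulaSet → Set
M ⊨Γ Γ = ∀ φ → Γ φ → M ⊨ φ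

_⊨ᴿ_ : ERel → FormulaSet → Set
R ⊨ᴿ Γ = ∀ (v : Valuation) → (v , R) ⊨Γ Γ

DefinableRels : (ERel → Set) → Set₁
DefinableRels K = Σ FormulaSet λ Γ → ∀ (R : ERel) → (R ⊨ᴿ Γ) ⇔ K R

DefinableModels : (Model → Set) → Set₁
DefinableModels K = Σ FormulaSet λ Γ → ∀ (M : Model) → (M ⊨Γ Γ) ⇔ K M

Symmetric : ERel → Set
Symmetric R = ∀ φ ψ → (φ , ψ) ∈R R → (ψ , φ) ∈R R

NegClosed : ERel → Set
NegClosed R = ∀ φ ψ → (¬' φ , ψ) ∈R R → (φ , ψ) ∈R R

Rsn : ERel → Set
Rsn R = Symmetric R × NegClosed R

Msn : Model → Set
Msn (v , R) = Symmetric R × NegClosed R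

-- The full relation lies in Rˢ ∩ Rⁿ, while removing the single pair ⟨⊤, ⊥⟩ (with
-- ⊤ = p₀ ∨ ¬p₀ and ⊥ = ¬⊤) breaks symmetry. No formula can tell the two apart:
-- the pair is only consulted by ⊤ △ ⊥ and ⊤ ↬ ⊥, which are false anyway because
-- ⊥ is false. So any Γ holding under the full relation holds under the smaller one.
module Submission where

open import Defs
open import Data.Product using (_×_; _,_)
open import Data.Sum using (_⊎_; inj₁; inj₂)
open import Data.Bool using (true; false; not; _∧_; _∨_)
open import Data.Bool.Properties using (∨-inverseʳ)
open import Relation.Nullary using (¬_)
open import Relation.Binary.PropositionalEquality using (_≡_; refl; cong; cong₂; trans; sym)
open import Function.Bundles using (Equivalence)

Indistinguishable : Model → Model → Set
Indistinguishable M N = ∀ χ → ⟦ χ ⟧ M ≡ ⟦ χ ⟧ N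

¬definableModels : ∀ {K : Model → Set} {M N : Model} →
  Indistinguishable M N → K M → ¬ K N → ¬ DefinableModels K
¬definableModels {M = M} {N} M≈N KM ¬KN (Γ , def) =
  ¬KN (Equivalence.to (def N) λ φ φ∈Γ →
    trans (sym (M≈N φ)) (Equivalence.from (def M) KM φ φ∈Γ))

¬definableRels : ∀ {K : ERel → Set} {R S : ERel} →
  (∀ v → Indistinguishable (v , R) (v , S)) → K R → ¬ K S → ¬ DefinableRels K
¬definableRels {R = R} {S} R≈S KR ¬KS (Γ , def) =
  ¬KS (Equivalence.to (def S) λ v φ φ∈Γ →
    trans (sym (R≈S v φ)) (Equivalence.from (def R) KR v φ φ∈Γ))

-- Whether ⟨φ, ψ⟩ ∈ R can never affect a truth value.
Inert : FOR → FOR → Set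
Inert φ ψ = ∀ M → M ⊨ φ × ⟦ ψ ⟧ M ≡ false

inert-△ : ∀ {φ ψ} → Inert φ ψ → ∀ M → ⟦ φ △ ψ ⟧ M ≡ false
inert-△ inert M with inert M
... | φ-true , ψ-false rewrite φ-true | ψ-false = refl

inert-↬ : ∀ {φ ψ} → Inert φ ψ → ∀ M → ⟦ φ ↬ ψ ⟧ M ≡ false
inert-↬ inert M with inert M
... | φ-true , ψ-false rewrite φ-true | ψ-false = refl

indistinguishable-upToInert : ∀ {R S : ERel} →
  (∀ φ ψ → R φ ψ ≡ S φ ψ ⊎ Inert φ ψ) → ∀ v → Indistinguishable (v , R) (v , S)
indistinguishable-upToInert {R} {S} agree v = go
  where
  go : Indistinguishable (v , R) (v , S)
  go (var n)  = refl
  go (¬' χ)   = cong not (go χ)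
  go (φ ∨' ψ) = cong₂ _∨_ (go φ) (go ψ)
  go (φ ∧' ψ) = cong₂ _∧_ (go φ) (go ψ)
  go (φ →' ψ) = cong₂ imp (go φ) (go ψ)
  go (φ ↔' ψ) = cong₂ iff (go φ) (go ψ)
  go (φ △ ψ) with agree φ ψ
  ... | inj₁ R≡S  = cong₂ _∧_ (cong₂ _∧_ (go φ) (go ψ)) R≡S
  ... | inj₂ inert = trans (inert-△ inert (v , R)) (sym (inert-△ inert (v , S)))
  go (φ ↬ ψ) with agree φ ψ
  ... | inj₁ R≡S  = cong₂ _∧_ (cong₂ imp (go φ) (go ψ)) R≡S
  ... | inj₂ inert = trans (inert-↬ inert (v , R)) (sym (inert-↬ inert (v , S)))

⊤' : FOR
⊤' = var 0 ∨' (¬' var 0)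

⊥' : FOR
⊥' = ¬' ⊤'

⊤⊥-inert : Inert ⊤' ⊥'
⊤⊥-inert (v , R) = ∨-inverseʳ (v 0) , cong not (∨-inverseʳ (v 0))

full : ERel
full _ _ = true

full-rsn : Rsn full
full-rsn = (λ _ _ _ → refl) , (λ _ _ _ → refl)

full-without-⊤⊥ : ERel
full-without-⊤⊥ (var 0 ∨' (¬' var 0)) (¬' (var 0 ∨' (¬' var 0))) = false
full-without-⊤⊥ _ _ = true

full-without-⊤⊥-asymmetric : ¬ Symmetric full-without-⊤⊥
full-without-⊤⊥-asymmetric symmetric with symmetric ⊥' ⊤' refl
... | ()

only-⊤⊥-removed : ∀ {φ ψ} → full-without-⊤⊥ φ ψ ≡ false → φ ≡ ⊤' × ψ ≡ ⊥'
only-⊤⊥-removed {var 0 ∨' (¬' var 0)} {¬' (var 0 ∨' (¬' var 0))} refl = refl , refl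

full≈full-without-⊤⊥ : ∀ v → Indistinguishable (v , full) (v , full-without-⊤⊥)
full≈full-without-⊤⊥ = indistinguishable-upToInert agree
  where
  agree : ∀ φ ψ → full φ ψ ≡ full-without-⊤⊥ φ ψ ⊎ Inert φ ψ
  agree φ ψ with full-without-⊤⊥ φ ψ in removed
  ... | true  = inj₁ refl
  ... | false with only-⊤⊥-removed removed
  ...   | refl , refl = inj₂ ⊤⊥-inert

full-without-⊤⊥-∉-Rsn : ¬ Rsn full-without-⊤⊥
full-without-⊤⊥-∉-Rsn (symmetric , _) = full-without-⊤⊥-asymmetric symmetric

mainTheorem14 : (¬ DefinableModels Msn) × (¬ DefinableRels Rsn)
mainTheorem14 =
    ¬definableModels (full≈full-without-⊤⊥ (λ _ → true)) full-rsn full-without-⊤⊥-∉-Rsn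
  , ¬definableRels full≈full-without-⊤⊥ full-rsn full-without-⊤⊥-∉-Rsn
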